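{- Let $\mathcal{T}_k=(Q_k,\mathcal{A},\mathcal{W},\to,Q_{k0},O_k)$, $k=1,2,3$, be cumulative weighted transition systems over a common input alphabet $\mathcal{A}$ and weight domain $\mathcal{W}$. (i) If $R_1\subseteq Q_1\times Q_2$ is a betterment relation between $\mathcal{T}_1$ and $\mathcal{T}_2$ and $R_2\subseteq Q_2\times Q_3$ is a betterment relation between $\mathcal{T}_2$ and $\mathcal{T}_3$, then $R_1\circ R_2=\{(p,s)\mid\exists q\in Q_2:(p,q)\in R_1,(q,s)\in R_2\}$ is a betterment relation between $\mathcal{T}_1$ and $\mathcal{T}_3$. (ii) If $R_i$ ($i\in I$) are betterment relations between $\mathcal{T}_1$ and $\mathcal{T}_2$, then $\bigcup_{i\in I}R_i$ is a betterment relation between $\mathcal{T}_1$ and $\mathcal{T}_2$.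
   Context: A weighted transition system $\mathcal{T}=(Q,\mathcal{A},\mathcal{W},\to,Q_0,O)$ has states $Q$, input alphabet $\mathcal{A}$, weight domain $\mathcal{W}$, weighted transitions $q\xrightarrow[w]{a}q'$ ($w\in\mathcal{W}$), initial states $Q_0$, and observation function $O:Q\to\mathcal{W}$. The weight domain is a partially ordered set $(\mathcal{W},\le_{\mathcal{W}})$ and a monoid $(\mathcal{W},\oplus,0)$ with $\oplus$ monotone and expansive; it may contain a maximum annihilating element $\omega$. The system is cumulative if $q\xrightarrow[w]{a}q'$ implies $O(q')=O(q)\oplus w$. Write $q\xrightarrow{a}_-q'$ if $q\xrightarrow[w]{a}q'$ for some $w<_{\mathcal{W}}\omega$ (any $w$ if there is no $\omega$). A betterment relation between $\mathcal{T}_1$ and $\mathcal{T}_2$ is a relation $R\subseteq Q_1\times Q_2$ such that whenever $(p,q)\in R$: (a) $O_2(q)\le_{\mathcal{W}}O_1(p)$; and (b) whenever $p\xrightarrow{a}_-p'$, there exists at least one $q'$ with $q\xrightarrow{a}_-q'$, and for every $q'$ with $q\xrightarrow{a}_-q'$ we have $(p',q')\in R$. -}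

module Defs where

open import Level using (Level; _⊔_; suc)
open import Data.Product using (Σ; _×_; _,_; ∃; ∃-syntax)
open import Data.Maybe using (Maybe; just; nothing)
open import Data.Unit.Polymorphic using (⊤)
open import Relation.Nullary using (¬_)
open import Relation.Binary.Bundles using (Poset)
open import Relation.Binary.PropositionalEquality using (_≡_)
open import Algebra.Structures using (IsMonoid)

record WeightDomain (c ℓ₁ ℓ₂ : Level) : Set (suc (c ⊔ ℓ₁ ⊔ ℓ₂)) where
  field
    poset : Poset c ℓ₁ ℓ₂
  open Poset poset public renaming (Carrier to W)
  field
    _⊕_ : W → W → W
    𝟘 : W
    isMonoid : IsMonoid _≈_ _⊕_ 𝟘
    ⊕-mono : ∀ {a b c d} → a ≤ b → c ≤ d → (a ⊕ c) ≤ (b ⊕ d)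
    ⊕-expansiveˡ : ∀ a b → a ≤ (a ⊕ b)
    ⊕-expansiveʳ : ∀ a b → b ≤ (a ⊕ b)
    ω? : Maybe W
    ω-max : ∀ {ω} → ω? ≡ just ω → ∀ w → w ≤ ω
    ω-annihilateˡ : ∀ {ω} → ω? ≡ just ω → ∀ w → (ω ⊕ w) ≈ ω
    ω-annihilateʳ : ∀ {ω} → ω? ≡ just ω → ∀ w → (w ⊕ ω) ≈ ω

  _<_ : W → W → Set (ℓ₁ ⊔ ℓ₂)
  a < b = (a ≤ b) × ¬ (a ≈ b)

  Below-ω : W → Set (ℓ₁ ⊔ ℓ₂)
  Below-ω w with ω?
  ... | just ω = w < ω
  ... | nothing = ⊤

module _ {c ℓ₁ ℓ₂ : Level} (𝒲 : WeightDomain c ℓ₁ ℓ₂) where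
  open WeightDomain 𝒲

  record WTS {a : Level} (A : Set a) (q t : Level) : Set (suc (q ⊔ t) ⊔ a ⊔ c) where
    field
      Q    : Set q
      Step : Q → A → W → Q → Set t
      Q₀   : Q → Set q
      O    : Q → W

    Step₋ : Q → A → Q → Set (c ⊔ t ⊔ ℓ₁ ⊔ ℓ₂)
    Step₋ p x p' = ∃[ w ] (Step p x w p' × Below-ω w)

  Cumulative : ∀ {a q t} {A : Set a} → WTS A q t → Set (a ⊔ q ⊔ t ⊔ c ⊔ ℓ₁)
  Cumulative T = ∀ {p x w p'} → Step p x w p' → O p' ≈ (O p ⊕ w)
    where open WTS T

  IsBetterment : ∀ {a q₁ t₁ q₂ t₂ r} {A : Set a} (T₁ : WTS A q₁ t₁) (T₂ : WTS A q₂ t₂) →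
                 (WTS.Q T₁ → WTS.Q T₂ → Set r) → Set _
  IsBetterment T₁ T₂ R =
    ∀ p q → R p q →
      (WTS.O T₂ q ≤ WTS.O T₁ p) ×
      (∀ x p' → WTS.Step₋ T₁ p x p' →
          (∃[ q' ] WTS.Step₋ T₂ q x q') ×
          (∀ q' → WTS.Step₋ T₂ q x q' → R p' q'))

_∘ᴿ_ : ∀ {a b c r s} {A : Set a} {B : Set b} {C : Set c} →
       (A → B → Set r) → (B → C → Set s) → (A → C → Set (b ⊔ r ⊔ s))
(R₁ ∘ᴿ R₂) p s = ∃[ q ] (R₁ p q × R₂ q s)

⋃ᴿ : ∀ {i a b r} {I : Set i} {A : Set a} {B : Set b} →
     (I → A → B → Set r) → (A → B → Set (i ⊔ r))
⋃ᴿ {I = I} R p q = Σ I (λ i → R i p q)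

module Submission where

-- Both closure properties hold for arbitrary weighted transition systems.
--     If p steps (below ω) to p', the middle state q of R₁ can step,
--     witnessing some q'; since R₂ relates q to s, s can step as well, and
--     every successor s' of s is related to q' by R₂ while p' is related to
--     q' by R₁, so (p', s') lies in the composite.
--   * Union: a pair in ⋃ R lies in some R j; every clause of the betterment
--     condition for R j transfers to the union by tagging with the index j.

open import Defs
open import Level using (Level; _⊔_)
open import Data.Product using (_×_; _,_; ∃-syntax)

module _ {c ℓ₁ ℓ₂ : Level} (𝒲 : WeightDomain c ℓ₁ ℓ₂) {a : Level} {A : Set a} where
  open WeightDomain 𝒲 using (trans)
  open WTS using (Q; Step₋)

  ∃-step : ∀ {q t : Level} (T : WTS 𝒲 A q t) → Q T → A → Set (c ⊔ ℓ₁ ⊔ ℓ₂ ⊔ q ⊔ t)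
  ∃-step T q x = ∃[ q' ] Step₋ T q x q'

  betterment-∘ :
    ∀ {q₁ q₂ q₃ t₁ t₂ t₃ r s : Level}
    (T₁ : WTS 𝒲 A q₁ t₁) (T₂ : WTS 𝒲 A q₂ t₂) (T₃ : WTS 𝒲 A q₃ t₃)
    (R₁ : Q T₁ → Q T₂ → Set r) (R₂ : Q T₂ → Q T₃ → Set s) →
    IsBetterment 𝒲 T₁ T₂ R₁ → IsBetterment 𝒲 T₂ T₃ R₂ →
    IsBetterment 𝒲 T₁ T₃ (R₁ ∘ᴿ R₂)
  betterment-∘ T₁ T₂ T₃ R₁ R₂ better₁ better₂ p s (q , pR₁q , qR₂s)
    with better₁ p q pR₁q | better₂ q s qR₂s
  ... | Oq≤Op , simulate₁ | Os≤Oq , simulate₂ = trans Os≤Oq Oq≤Op , simulate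
    where
    simulate : ∀ x p' → Step₋ T₁ p x p' →
               (∃-step T₃ s x) × (∀ s' → Step₋ T₃ s x s' → (R₁ ∘ᴿ R₂) p' s')
    simulate x p' p⇒p' with simulate₁ x p' p⇒p'
    ... | (q' , q⇒q') , p'R₁succ with simulate₂ x q' q⇒q'
    ... | s-steps , q'R₂succ = s-steps , λ s' s⇒s' → q' , p'R₁succ q' q⇒q' , q'R₂succ s' s⇒s'

  betterment-⋃ :
    ∀ {q₁ q₂ t₁ t₂ r i : Level}
    (T₁ : WTS 𝒲 A q₁ t₁) (T₂ : WTS 𝒲 A q₂ t₂)
    (I : Set i) (R : I → Q T₁ → Q T₂ → Set r) →
    (∀ j → IsBetterment 𝒲 T₁ T₂ (R j)) →
    IsBetterment 𝒲 T₁ T₂ (⋃ᴿ R)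
  betterment-⋃ T₁ T₂ I R better p q (j , pRⱼq) with better j p q pRⱼq
  ... | Oq≤Op , simulate = Oq≤Op , λ x p' p⇒p' → tag (simulate x p' p⇒p')
    where
    tag : ∀ {x p'} → (∃-step T₂ q x) × (∀ q' → Step₋ T₂ q x q' → R j p' q') →
          (∃-step T₂ q x) × (∀ q' → Step₋ T₂ q x q' → ⋃ᴿ R p' q')
    tag (q-steps , related) = q-steps , λ q' q⇒q' → j , related q' q⇒q'

proposition6 : ∀ {c ℓ₁ ℓ₂ a q₁ q₂ q₃ t₁ t₂ t₃ r s i : Level} (𝒲 : WeightDomain c ℓ₁ ℓ₂) {A : Set a}
    (T₁ : WTS 𝒲 A q₁ t₁) (T₂ : WTS 𝒲 A q₂ t₂) (T₃ : WTS 𝒲 A q₃ t₃) →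
    Cumulative 𝒲 T₁ → Cumulative 𝒲 T₂ → Cumulative 𝒲 T₃ →
    (∀ (R₁ : WTS.Q T₁ → WTS.Q T₂ → Set r) (R₂ : WTS.Q T₂ → WTS.Q T₃ → Set s) →
       IsBetterment 𝒲 T₁ T₂ R₁ → IsBetterment 𝒲 T₂ T₃ R₂ →
       IsBetterment 𝒲 T₁ T₃ (R₁ ∘ᴿ R₂))
    ×
    (∀ (I : Set i) (R : I → WTS.Q T₁ → WTS.Q T₂ → Set r) →
       (∀ j → IsBetterment 𝒲 T₁ T₂ (R j)) →
       IsBetterment 𝒲 T₁ T₂ (⋃ᴿ R))
proposition6 𝒲 T₁ T₂ T₃ _ _ _ =
  betterment-∘ 𝒲 T₁ T₂ T₃ , betterment-⋃ 𝒲 T₁ T₂
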